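{- There is a first-order interpretation $\mathcal I$ of $\tau_{\text{les-r}}$ in $\tau_{\text{les-r}}$ such that for every linear equation system $\mathcal S$ of the form $A_\ell\cdot\mathbf x+(\mathbf x^t\cdot A_r)^t=\mathbf b$ over a finite (not necessarily commutative) ring $R$, with $A_\ell\in R^{I\times J}$, $A_r\in R^{J\times I}$, $\mathbf b\in R^I$, the structure $\mathcal I(\mathcal S)$ describes a system $\mathcal S^\star\colon A^\star\cdot_{\mathbb Z}\mathbf x^\star=\mathbf b^\star$ over the $\mathbb Z$-module $(R,+)$ (with $A^\star$ a matrix and $\mathbf b^\star$ a vector with entries in $R$, and variables ranging over $\mathbb Z$) such that $\mathcal S$ is solvable over $R$ if and only if $\mathcal S^\star$ has a solution $\mathbf x^\star$ with integer entries, i.e. there are integers $x^\star_j$ with $\sum_j x^\star_j\, A^\star(i,j)=\mathbf b^\star(i)$ for all $i$.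
   Context: All structures are finite. A first-order interpretation of $\tau$ in $\sigma$ is a tuple of first-order $\sigma$-formulas defining (on $m$-tuples) a domain $\delta$, an equivalence $\varepsilon$, and each relation/constant of $\tau$, mapping a $\sigma$-structure to a $\tau$-structure. $\tau_{\text{les-r}}=(R,A,b,+,\cdot,1,0)$ with $R$ unary (ring elements), $A$ ternary (matrix entries), $b$ binary (vector entries), and ring operations; for a non-commutative ring a system $A_\ell\mathbf x+(\mathbf x^tA_r)^t=\mathbf b$ is encoded analogously (with the two coefficient matrices). Such a system is solvable if there is $\mathbf x\in R^J$ satisfying it. -}

module Defs where

open import Level using (0ℓ)
open import Data.Nat using (ℕ; zero; suc)
open import Data.Integer using (ℤ; +_; -[1+_])
open import Data.Fin using (Fin; zero; suc)
open import Data.Maybe using (Maybe; just; nothing)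
open import Data.Product using (Σ; ∃; _×_; _,_; proj₁; proj₂)
open import Data.Sum using (_⊎_; inj₁; inj₂; [_,_]′)
open import Data.Unit using (⊤)
open import Data.Empty using (⊥)
open import Function using (_∘_)
open import Function.Bundles using (_⇔_)
open import Relation.Nullary using (¬_)
open import Relation.Binary using (Rel; IsEquivalence)
open import Relation.Binary.PropositionalEquality using (_≡_)
open import Algebra.Core using (Op₁; Op₂)
open import Algebra.Structures using (IsRing)

-- R (unary: ring elements), Aℓ / Ar (ternary: entries of the left / right
-- coefficient matrix), B (binary: entries of the right-hand side),
-- Add / Mul (ternary: graphs of + and ·), One / Zero (unary: the constants).

data Sym : Set where
  R Add Mul One Zero Aℓ Ar B : Sym

arity : Sym → ℕ
arity R    = 1
arity Add  = 3
arity Mul  = 3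
arity One  = 1
arity Zero = 1
arity Aℓ   = 3
arity Ar   = 3
arity B    = 2

record Structure : Set₁ where
  field
    Carrier : Set
    rel     : (s : Sym) → (Fin (arity s) → Carrier) → Set
open Structure public

data Formula : Set → Set₁ where
  atom : ∀ {V} (s : Sym) → (Fin (arity s) → V) → Formula V
  _≐_  : ∀ {V} → V → V → Formula V
  ¬'   : ∀ {V} → Formula V → Formula V
  _∧'_ : ∀ {V} → Formula V → Formula V → Formula V
  ∃'   : ∀ {V} → Formula (Maybe V) → Formula V

extend : ∀ {V : Set} {C : Set} → (V → C) → C → Maybe V → C
extend env a nothing  = a
extend env a (just v) = env v

⟦_⟧ : ∀ {V} → Formula V → (𝔄 : Structure) → (V → Carrier 𝔄) → Set
⟦ atom s vs ⟧ 𝔄 env = rel 𝔄 s (env ∘ vs)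
⟦ x ≐ y ⟧     𝔄 env = env x ≡ env y
⟦ ¬' φ ⟧      𝔄 env = ¬ (⟦ φ ⟧ 𝔄 env)
⟦ φ ∧' ψ ⟧    𝔄 env = ⟦ φ ⟧ 𝔄 env × ⟦ ψ ⟧ 𝔄 env
⟦ ∃' φ ⟧      𝔄 env = Σ (Carrier 𝔄) λ a → ⟦ φ ⟧ 𝔄 (extend env a)

record Interpretation (m : ℕ) : Set₁ where
  field
    δ : Formula (Fin m)
    ε : Formula (Fin m ⊎ Fin m)
    φ : (s : Sym) → Formula (Fin (arity s) × Fin m)
open Interpretation public

-- The structure I(𝔄) before factoring by ε: domain = δ-tuples.
apply : ∀ {m} → Interpretation m → Structure → Structure
apply {m} 𝓘 𝔄 = record
  { Carrier = Σ (Fin m → Carrier 𝔄) (λ t → ⟦ δ 𝓘 ⟧ 𝔄 t)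
  ; rel     = λ s ds → ⟦ φ 𝓘 s ⟧ 𝔄 (λ kl → proj₁ (ds (proj₁ kl)) (proj₂ kl))
  }

eqv : ∀ {m} (𝓘 : Interpretation m) (𝔄 : Structure) → Rel (Carrier (apply 𝓘 𝔄)) 0ℓ
eqv 𝓘 𝔄 d d' = ⟦ ε 𝓘 ⟧ 𝔄 [ proj₁ d , proj₁ d' ]′

record FinRing : Set where
  field
    r      : ℕ
    _+_    : Op₂ (Fin r)
    _*_    : Op₂ (Fin r)
    -_     : Op₁ (Fin r)
    0# 1#  : Fin r
    isRing : IsRing _≡_ _+_ _*_ -_ 0# 1#
open FinRing public

module _ (Rg : FinRing) where
  open FinRing Rg using () renaming (_+_ to _⊕_; _*_ to _⊛_; -_ to ⊖_)

  sumR : ∀ {q} → (Fin q → Fin (r Rg)) → Fin (r Rg)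
  sumR {zero}  f = 0# Rg
  sumR {suc q} f = f zero ⊕ sumR (f ∘ suc)

  natmul : ℕ → Fin (r Rg) → Fin (r Rg)
  natmul zero    a = 0# Rg
  natmul (suc n) a = a ⊕ natmul n a

  zmul : ℤ → Fin (r Rg) → Fin (r Rg)
  zmul (+ n)      a = natmul n a
  zmul -[1+ n ]   a = ⊖ natmul (suc n) a

  -- A system  Aℓ·x + (xᵗ·Ar)ᵗ = b  with I = Fin p, J = Fin q.
  record System : Set where
    field
      p q : ℕ
      Al  : Fin p → Fin q → Fin (r Rg)
      Arm : Fin q → Fin p → Fin (r Rg)
      b   : Fin p → Fin (r Rg)

  Solvable : System → Set
  Solvable S = ∃ λ (x : Fin q → Fin (r Rg)) → ∀ i →
      (sumR (λ j → Al i j ⊛ x j) ⊕ sumR (λ j → x j ⊛ Arm j i)) ≡ b i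
    where open System S

  record ZSystem : Set where
    field
      p q : ℕ
      A   : Fin p → Fin q → Fin (r Rg)
      b   : Fin p → Fin (r Rg)

  ZSolvable : ZSystem → Set
  ZSolvable S = ∃ λ (x : Fin q → ℤ) → ∀ i → sumR (λ j → zmul (x j) (A i j)) ≡ b i
    where open ZSystem S

  -- Canonical encoding of a system as a τ_les-r structure with
  -- universe R ⊎ I ⊎ J.

  Univ : ℕ → ℕ → Set
  Univ p q = Fin (r Rg) ⊎ (Fin p ⊎ Fin q)

  el : ∀ {p q} → Fin (r Rg) → Univ p q
  el = inj₁
  row : ∀ {p q} → Fin p → Univ p q
  row i = inj₂ (inj₁ i)
  col : ∀ {p q} → Fin q → Univ p q
  col j = inj₂ (inj₂ j)

  encode : System → Structure
  encode S = record { Carrier = Univ p q ; rel = rl }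
    where
      open System S
      rl : (s : Sym) → (Fin (arity s) → Univ p q) → Set
      rl R    xs = ∃ λ a → xs zero ≡ el a
      rl Add  xs = ∃ λ a → ∃ λ c → xs zero ≡ el a × xs (suc zero) ≡ el c
                     × xs (suc (suc zero)) ≡ el (a ⊕ c)
      rl Mul  xs = ∃ λ a → ∃ λ c → xs zero ≡ el a × xs (suc zero) ≡ el c
                     × xs (suc (suc zero)) ≡ el (a ⊛ c)
      rl One  xs = xs zero ≡ el (1# Rg)
      rl Zero xs = xs zero ≡ el (0# Rg)
      rl Aℓ   xs = ∃ λ i → ∃ λ j → xs zero ≡ row i × xs (suc zero) ≡ col j
                     × xs (suc (suc zero)) ≡ el (Al i j)
      rl Ar   xs = ∃ λ j → ∃ λ i → xs zero ≡ col j × xs (suc zero) ≡ row i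
                     × xs (suc (suc zero)) ≡ el (Arm j i)
      rl B    xs = ∃ λ i → xs zero ≡ row i × xs (suc zero) ≡ el (b i)

  -- A ℤ-system is encoded like a system with A⋆ as left matrix
  -- (the right matrix is irrelevant; it is not pinned down below).
  toSystem : ZSystem → System
  toSystem S = record { p = p ; q = q ; Al = A ; Arm = λ _ _ → 0# Rg ; b = b }
    where open ZSystem S

-- Symbols relevant for describing a system over the ℤ-module (R,+).
Pinned : Sym → Set
Pinned R   = ⊤
Pinned Add = ⊤
Pinned Aℓ  = ⊤
Pinned B   = ⊤
Pinned _   = ⊥

IsoModulo : (𝔅 : Structure) → Rel (Carrier 𝔅) 0ℓ → (𝔄 : Structure) → Set
IsoModulo 𝔅 _≈_ 𝔄 =
  IsEquivalence _≈_ ×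
  Σ (Carrier 𝔄 → Carrier 𝔅) λ h →
    (∀ x y → h x ≈ h y → x ≡ y) ×
    (∀ d → ∃ λ x → h x ≈ d) ×
    (∀ s → Pinned s → ∀ (ds : Fin (arity s) → Carrier 𝔅) →
       rel 𝔅 s ds ⇔ (∃ λ xs → (∀ k → h (xs k) ≈ ds k) × rel 𝔄 s xs))

Describes : ∀ {m} (𝓘 : Interpretation m) (𝔄 : Structure) (Rg : FinRing) →
            ZSystem Rg → Set
Describes 𝓘 𝔄 Rg S⋆ = IsoModulo (apply 𝓘 𝔄) (eqv 𝓘 𝔄) (encode Rg (toSystem Rg S⋆))

-- Over the ℤ-module (R, +) an unknown x_j ∈ R is replaced by integer unknowns x⋆(j,s), one
-- for each pair (j, s) ∈ J × R, read as x_j = Σ_s x⋆(j,s)·s.  Since x ↦ Aℓ(i,j)·x + x·Ar(j,i)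
-- is additive, row i of S becomes Σ_(j,s) x⋆(j,s)·(Aℓ(i,j)·s + s·Ar(j,i)) = b_i; conversely a
-- solution x of S yields the solution x⋆(j,s) = [s = x_j].  The coefficients of S⋆ are
-- first-order definable from Aℓ, Ar, · and +, so S⋆ is obtained by a 2-dimensional
-- interpretation whose domain consists of the pairs (a, a) for ring elements a, (i, i) for
-- rows i, and (j, s) for the columns (j, s) of S⋆.

module Submission where

open import Level using (0ℓ)
open import Data.Bool using (if_then_else_)
open import Data.Empty using (⊥-elim)
open import Data.Fin using (Fin; zero; suc; _↑ˡ_; _↑ʳ_; combine; quotient; remainder)
open import Data.Fin.Patterns using (0F; 1F; 2F)
open import Data.Fin.Properties
  using (_≟_; suc-injective; remQuot-combine; combine-remQuot; combine-injective)
open import Data.Integer using (ℤ; +_; -[1+_])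
open import Data.Maybe using (Maybe; just; nothing)
open import Data.Nat using (ℕ; zero; suc)
import Data.Nat as ℕ
open import Data.Product using (Σ; ∃; _×_; _,_; proj₁; proj₂)
open import Data.Product.Function.Dependent.Propositional using (congˡ)
open import Data.Product.Function.NonDependent.Propositional using (_×-⇔_)
open import Data.Sum using (_⊎_; inj₁; inj₂)
open import Data.Sum.Properties using (≡-dec; inj₂-injective)
open import Data.Vec.Functional using ([]; _∷_)
open import Function using (_∘_)
open import Function.Bundles using (_⇔_; mk⇔; Equivalence)
open import Relation.Binary using (Rel; IsEquivalence)
open import Relation.Binary.Definitions using (DecidableEquality)
open import Relation.Binary.PropositionalEquality using (_≡_; _≢_)
import Relation.Binary.PropositionalEquality as ≡
open import Relation.Nullary using (¬_; yes; no; does; contradiction)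
open import Relation.Nullary.Decidable using (decidable-stable)
open import Algebra.Bundles using (Monoid; Ring)
open import Defs hiding (Carrier; _+_; _*_; -_; 0#; 1#)

module MonoidSum {c ℓ} (M : Monoid c ℓ) where
  open Monoid M renaming (_∙_ to _+_; ε to 0#)
  open import Algebra.Properties.Monoid.Sum M
  open import Relation.Binary.Reasoning.Setoid setoid

  sum-splitAt : ∀ m {n} (f : Fin (m ℕ.+ n) → Carrier) →
                sum f ≈ sum (f ∘ (_↑ˡ n)) + sum (f ∘ (m ↑ʳ_))
  sum-splitAt zero    f = sym (identityˡ _)
  sum-splitAt (suc m) f = trans (∙-congˡ (sum-splitAt m (f ∘ suc))) (sym (assoc _ _ _))

  sum-combine : ∀ m {n} (f : Fin (m ℕ.* n) → Carrier) →
                sum f ≈ ∑[ i < m ] ∑[ j < n ] f (combine i j)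
  sum-combine zero    f = refl
  sum-combine (suc m) {n} f =
    trans (sum-splitAt n f) (∙-congˡ (sum-combine m (f ∘ (n ↑ʳ_))))

  sum-supported-at : ∀ {n} (f : Fin n → Carrier) i →
                     (∀ j → j ≢ i → f j ≈ 0#) → sum f ≈ f i
  sum-supported-at {suc n} f zero vanish = begin
    f zero + sum (f ∘ suc)      ≈⟨ ∙-congˡ (sum-cong-≋ {n} λ j → vanish (suc j) λ ()) ⟩
    f zero + sum {n} (λ _ → 0#) ≈⟨ ∙-congˡ (sum-replicate-zero n) ⟩
    f zero + 0#                 ≈⟨ identityʳ _ ⟩
    f zero                      ∎
  sum-supported-at f (suc i) vanish = begin
    f zero + sum (f ∘ suc) ≈⟨ ∙-cong (vanish zero λ ()) (sum-supported-at (f ∘ suc) i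
                                λ j j≢i → vanish (suc j) (j≢i ∘ suc-injective)) ⟩
    0# + f (suc i)         ≈⟨ identityˡ _ ⟩
    f (suc i)              ∎

kronecker : ∀ {n} → Fin n → Fin n → ℤ
kronecker i j = if does (i ≟ j) then + 1 else + 0

module IntegerMultiple {c ℓ} (R : Ring c ℓ) where
  open Ring R
  open import Algebra.Properties.Semiring.Sum semiring
  open MonoidSum +-monoid
  open import Algebra.Properties.Ring R using (-‿distribˡ-*; -‿distribʳ-*)
  open import Algebra.Properties.AbelianGroup +-abelianGroup using (⁻¹-∙-comm)
  open import Algebra.Properties.Semiring.Mult semiring renaming (_×_ to _·ℕ_)
  open import Algebra.Properties.CommutativeMonoid.Mult +-commutativeMonoid using (×-distrib-+)
  open import Relation.Binary.Reasoning.Setoid setoid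

  infixr 7 _·ℤ_
  _·ℤ_ : ℤ → Carrier → Carrier
  (+ n)    ·ℤ x = n ·ℕ x
  -[1+ n ] ·ℤ x = - (suc n ·ℕ x)

  ·ℤ-identityˡ : ∀ x → (+ 1) ·ℤ x ≈ x
  ·ℤ-identityˡ = ×-homo-1

  ·ℤ-distrib-+ : ∀ z x y → z ·ℤ (x + y) ≈ z ·ℤ x + z ·ℤ y
  ·ℤ-distrib-+ (+ n)    x y = ×-distrib-+ x y n
  ·ℤ-distrib-+ -[1+ n ] x y = begin
    - (suc n ·ℕ (x + y))            ≈⟨ -‿cong (×-distrib-+ x y (suc n)) ⟩
    - (suc n ·ℕ x + suc n ·ℕ y)     ≈⟨ sym (⁻¹-∙-comm _ _) ⟩
    - (suc n ·ℕ x) + - (suc n ·ℕ y) ∎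

  ·ℤ-comm-* : ∀ z x y → x * (z ·ℤ y) ≈ z ·ℤ (x * y)
  ·ℤ-comm-* (+ n)    x y = ×-comm-* n x y
  ·ℤ-comm-* -[1+ n ] x y = begin
    x * - (suc n ·ℕ y)   ≈⟨ sym (-‿distribʳ-* x _) ⟩
    - (x * (suc n ·ℕ y)) ≈⟨ -‿cong (×-comm-* (suc n) x y) ⟩
    - (suc n ·ℕ (x * y)) ∎

  ·ℤ-assoc-* : ∀ z x y → (z ·ℤ x) * y ≈ z ·ℤ (x * y)
  ·ℤ-assoc-* (+ n)    x y = ×-assoc-* n x y
  ·ℤ-assoc-* -[1+ n ] x y = begin
    - (suc n ·ℕ x) * y   ≈⟨ sym (-‿distribˡ-* _ y) ⟩
    - ((suc n ·ℕ x) * y) ≈⟨ -‿cong (×-assoc-* (suc n) x y) ⟩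
    - (suc n ·ℕ (x * y)) ∎

  ∑-kronecker : ∀ {n} (f : Fin n → Carrier) i → ∑[ j < n ] (kronecker i j ·ℤ f j) ≈ f i
  ∑-kronecker f i = trans (sum-supported-at _ i off-diagonal) diagonal
    where
    off-diagonal : ∀ j → j ≢ i → kronecker i j ·ℤ f j ≈ 0#
    off-diagonal j j≢i with i ≟ j
    ... | yes i≡j = contradiction (≡.sym i≡j) j≢i
    ... | no _    = refl
    diagonal : kronecker i i ·ℤ f i ≈ f i
    diagonal with i ≟ i
    ... | yes _  = ·ℤ-identityˡ (f i)
    ... | no i≢i = contradiction ≡.refl i≢i

toRing : FinRing → Ring 0ℓ 0ℓ
toRing Rg = record { isRing = isRing Rg }

module Linearisation (Rg : FinRing) where
  open Ring (toRing Rg)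
  open IntegerMultiple (toRing Rg)
  open import Algebra.Properties.Semiring.Sum semiring
  open MonoidSum +-monoid
  open import Algebra.Properties.Semiring.Mult semiring using () renaming (_×_ to _·ℕ_)
  open ≡.≡-Reasoning

  sumR≡sum : ∀ {n} (f : Fin n → Carrier) → sumR Rg f ≡ sum f
  sumR≡sum {zero}  f = ≡.refl
  sumR≡sum {suc n} f = ≡.cong₂ _+_ ≡.refl (sumR≡sum (f ∘ suc))

  natmul≡·ℕ : ∀ n x → natmul Rg n x ≡ n ·ℕ x
  natmul≡·ℕ zero    x = ≡.refl
  natmul≡·ℕ (suc n) x = ≡.cong₂ _+_ ≡.refl (natmul≡·ℕ n x)

  zmul≡·ℤ : ∀ z x → zmul Rg z x ≡ z ·ℤ x
  zmul≡·ℤ (+ n)    x = natmul≡·ℕ n x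
  zmul≡·ℤ -[1+ n ] x = ≡.cong -_ (natmul≡·ℕ (suc n) x)

  module _ (S : System Rg) where
    open System S

    coeff : Fin p → Fin q → Carrier → Carrier
    coeff i j s = Al i j * s + s * Arm j i

    A⋆ : Fin p → Fin (q ℕ.* r Rg) → Carrier
    A⋆ i k = coeff i (quotient (r Rg) k) (remainder {q} (r Rg) k)

    linearise : ZSystem Rg
    linearise = record { p = p ; q = q ℕ.* r Rg ; A = A⋆ ; b = b }

    A⋆-combine : ∀ i j s → A⋆ i (combine j s) ≡ coeff i j s
    A⋆-combine i j s = ≡.cong (λ js → coeff i (proj₁ js) (proj₂ js)) (remQuot-combine j s)

    system-lhs : ∀ i (x : Fin q → Carrier) →
      sumR Rg (λ j → Al i j * x j) + sumR Rg (λ j → x j * Arm j i) ≡ ∑[ j < q ] (coeff i j (x j))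
    system-lhs i x = begin
      sumR Rg left + sumR Rg right           ≡⟨ ≡.cong₂ _+_ (sumR≡sum left) (sumR≡sum right) ⟩
      ∑[ j < q ] left j + ∑[ j < q ] right j ≡⟨ ∑-distrib-+ left right ⟨
      ∑[ j < q ] (coeff i j (x j))           ∎
      where
      left right : Fin q → Carrier
      left  j = Al i j * x j
      right j = x j * Arm j i

    linearised-lhs : ∀ i (z : Fin (q ℕ.* r Rg) → ℤ) →
      sumR Rg (λ k → zmul Rg (z k) (A⋆ i k))
        ≡ ∑[ j < q ] ∑[ s < r Rg ] (z (combine j s) ·ℤ coeff i j s)
    linearised-lhs i z = begin
      sumR Rg term                                ≡⟨ sumR≡sum term ⟩
      ∑[ k < q ℕ.* r Rg ] term k                  ≡⟨ sum-combine q term ⟩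
      ∑[ j < q ] ∑[ s < r Rg ] term (combine j s) ≡⟨ sum-cong-≗ {q} (sum-cong-≗ {r Rg} ∘ term-combine) ⟩
      ∑[ j < q ] ∑[ s < r Rg ] (z (combine j s) ·ℤ coeff i j s) ∎
      where
      term : Fin (q ℕ.* r Rg) → Carrier
      term k = zmul Rg (z k) (A⋆ i k)
      term-combine : ∀ j s → term (combine j s) ≡ z (combine j s) ·ℤ coeff i j s
      term-combine j s =
        ≡.trans (zmul≡·ℤ (z (combine j s)) _) (≡.cong (z (combine j s) ·ℤ_) (A⋆-combine i j s))

    coeff-linear : ∀ i j (n : Fin (r Rg) → ℤ) →
      coeff i j (∑[ s < r Rg ] (n s ·ℤ s)) ≡ ∑[ s < r Rg ] (n s ·ℤ coeff i j s)
    coeff-linear i j n = begin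
      Al i j * (∑[ s < r Rg ] (n s ·ℤ s)) + (∑[ s < r Rg ] (n s ·ℤ s)) * Arm j i
        ≡⟨ ≡.cong₂ _+_ (*-distribˡ-sum (Al i j) x) (*-distribʳ-sum (Arm j i) x) ⟩
      ∑[ s < r Rg ] (Al i j * (n s ·ℤ s)) + ∑[ s < r Rg ] ((n s ·ℤ s) * Arm j i)
        ≡⟨ ≡.cong₂ _+_ (sum-cong-≗ {r Rg} λ s → ·ℤ-comm-* (n s) _ s)
                       (sum-cong-≗ {r Rg} λ s → ·ℤ-assoc-* (n s) s _) ⟩
      ∑[ s < r Rg ] (n s ·ℤ (Al i j * s)) + ∑[ s < r Rg ] (n s ·ℤ (s * Arm j i))
        ≡⟨ ∑-distrib-+ (λ s → n s ·ℤ (Al i j * s)) (λ s → n s ·ℤ (s * Arm j i)) ⟨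
      ∑[ s < r Rg ] (n s ·ℤ (Al i j * s) + n s ·ℤ (s * Arm j i))
        ≡⟨ sum-cong-≗ {r Rg} (λ s → ·ℤ-distrib-+ (n s) _ _) ⟨
      ∑[ s < r Rg ] (n s ·ℤ coeff i j s) ∎
      where
      x : Fin (r Rg) → Carrier
      x s = n s ·ℤ s

    solvable⇒linearised-solvable : Solvable Rg S → ZSolvable Rg linearise
    solvable⇒linearised-solvable (x , solves) = z , λ i → begin
      sumR Rg (λ k → zmul Rg (z k) (A⋆ i k))
        ≡⟨ linearised-lhs i z ⟩
      ∑[ j < q ] ∑[ s < r Rg ] (z (combine j s) ·ℤ coeff i j s)
        ≡⟨ sum-cong-≗ {q} (λ j → ≡.trans (sum-cong-≗ {r Rg} λ s → ≡.cong (_·ℤ coeff i j s) (z-combine j s))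
                                         (∑-kronecker (coeff i j) (x j))) ⟩
      ∑[ j < q ] (coeff i j (x j))
        ≡⟨ system-lhs i x ⟨
      sumR Rg (λ j → Al i j * x j) + sumR Rg (λ j → x j * Arm j i)
        ≡⟨ solves i ⟩
      b i ∎
      where
      z : Fin (q ℕ.* r Rg) → ℤ
      z k = kronecker (x (quotient (r Rg) k)) (remainder {q} (r Rg) k)
      z-combine : ∀ j s → z (combine j s) ≡ kronecker (x j) s
      z-combine j s = ≡.cong (λ js → kronecker (x (proj₁ js)) (proj₂ js)) (remQuot-combine j s)

    linearised-solvable⇒solvable : ZSolvable Rg linearise → Solvable Rg S
    linearised-solvable⇒solvable (z , solves) = x , λ i → begin
      sumR Rg (λ j → Al i j * x j) + sumR Rg (λ j → x j * Arm j i)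
        ≡⟨ system-lhs i x ⟩
      ∑[ j < q ] (coeff i j (x j))
        ≡⟨ sum-cong-≗ {q} (λ j → coeff-linear i j (z ∘ combine j)) ⟩
      ∑[ j < q ] ∑[ s < r Rg ] (z (combine j s) ·ℤ coeff i j s)
        ≡⟨ linearised-lhs i z ⟨
      sumR Rg (λ k → zmul Rg (z k) (A⋆ i k))
        ≡⟨ solves i ⟩
      b i ∎
      where
      x : Fin q → Carrier
      x j = ∑[ s < r Rg ] (z (combine j s) ·ℤ s)

    solvable⇔linearised-solvable : Solvable Rg S ⇔ ZSolvable Rg linearise
    solvable⇔linearised-solvable = mk⇔ solvable⇒linearised-solvable linearised-solvable⇒solvable

module _ {𝔅 𝔄 : Structure} {_≈_ : Rel (Structure.Carrier 𝔅) 0ℓ} where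

  isoModulo-byDecoding :
    IsEquivalence _≈_ →
    (h : Structure.Carrier 𝔄 → Structure.Carrier 𝔅)
    (decode : Structure.Carrier 𝔅 → Structure.Carrier 𝔄) →
    (∀ x → decode (h x) ≡ x) →
    (∀ d d′ → d ≈ d′ → decode d ≡ decode d′) →
    (∀ d → h (decode d) ≈ d) →
    (∀ s → Pinned s → ∀ ds xs → (∀ k → decode (ds k) ≡ xs k) →
       rel 𝔅 s ds ⇔ rel 𝔄 s xs) →
    IsoModulo 𝔅 _≈_ 𝔄
  isoModulo-byDecoding ≈-equiv h decode decode-h decode-cong h-decode rel-decode =
    ≈-equiv , h , h-injective , (λ d → decode d , h-decode d) , rel-h
    where
    h-injective : ∀ x y → h x ≈ h y → x ≡ y
    h-injective x y hx≈hy =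
      ≡.trans (≡.sym (decode-h x)) (≡.trans (decode-cong _ _ hx≈hy) (decode-h y))

    rel-h : ∀ s → Pinned s → ∀ ds →
            rel 𝔅 s ds ⇔ ∃ λ xs → (∀ k → h (xs k) ≈ ds k) × rel 𝔄 s xs
    rel-h s pinned ds = mk⇔
      (λ r → decode ∘ ds , h-decode ∘ ds
           , Equivalence.to (rel-decode s pinned ds (decode ∘ ds) λ _ → ≡.refl) r)
      (λ (xs , hxs≈ds , r) → Equivalence.from (rel-decode s pinned ds xs
          λ k → ≡.trans (≡.sym (decode-cong _ _ (hxs≈ds k))) (decode-h (xs k))) r)

X Y : Fin 2
X = 0F
Y = 1F

infixr 4 _⇒′_
_⇒′_ : ∀ {V} → Formula V → Formula V → Formula V
φ ⇒′ ψ = ¬' (φ ∧' ¬' ψ)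

isRow : ∀ {V} → V → Formula V
isRow v = ∃' (atom B (just v ∷ nothing ∷ []))

isCol : ∀ {V} → V → Formula V
isCol v = ¬' (atom R (v ∷ [])) ∧' ¬' (isRow v)

δ⋆ : Formula (Fin 2)
δ⋆ =  (atom R (X ∷ []) ⇒′ X ≐ Y)
   ∧' ((isRow X ⇒′ X ≐ Y)
   ∧'  (isCol X ⇒′ atom R (Y ∷ [])))

ε⋆ : Formula (Fin 2 ⊎ Fin 2)
ε⋆ = (inj₁ X ≐ inj₂ X) ∧' (inj₁ Y ≐ inj₂ Y)

-- φ⋆Aℓ((x₀,y₀),(x₁,y₁),(x₂,y₂)) says x₂ = Aℓ(x₀,x₁)·y₁ + y₁·Ar(x₁,x₀), i.e. x₂ is the entry of
-- A⋆ in row x₀ and column (x₁, y₁); u = Aℓ(x₀,x₁), v = u·y₁, u′ = Ar(x₁,x₀), v′ = y₁·u′.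
φ⋆Aℓ : Formula (Fin 3 × Fin 2)
φ⋆Aℓ = ∃' (∃' (∃' (∃'
    (atom Aℓ (↑ (0F , X) ∷ ↑ (1F , X) ∷ u ∷ [])
  ∧' (atom Mul (u ∷ ↑ (1F , Y) ∷ v ∷ [])
  ∧' (atom Ar (↑ (1F , X) ∷ ↑ (0F , X) ∷ u′ ∷ [])
  ∧' (atom Mul (↑ (1F , Y) ∷ u′ ∷ v′ ∷ [])
  ∧' atom Add (v ∷ v′ ∷ ↑ (2F , X) ∷ []))))))))
  where
  ↑ : Fin 3 × Fin 2 → Maybe (Maybe (Maybe (Maybe (Fin 3 × Fin 2))))
  ↑ = just ∘ just ∘ just ∘ just
  u v u′ v′ : Maybe (Maybe (Maybe (Maybe (Fin 3 × Fin 2))))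
  u  = just (just (just nothing))
  v  = just (just nothing)
  u′ = just nothing
  v′ = nothing

-- R, Add and B act on first coordinates; the remaining symbols are not pinned by Describes.
φ⋆ : (s : Sym) → Formula (Fin (arity s) × Fin 2)
φ⋆ Aℓ = φ⋆Aℓ
φ⋆ s  = atom s (λ k → k , X)

𝓘 : Interpretation 2
𝓘 = record { δ = δ⋆ ; ε = ε⋆ ; φ = φ⋆ }

module Correctness (Rg : FinRing) (S : System Rg) where
  open System S
  open FinRing Rg using (0#)
  open Linearisation Rg using (coeff; linearise; A⋆-combine)
  open ≡ using (refl)

  𝔄 𝔄⋆ : Structure
  𝔄  = encode Rg S
  𝔄⋆ = encode Rg (toSystem Rg (linearise S))

  U U⋆ : Set
  U  = Univ Rg p q
  U⋆ = Univ Rg p (q ℕ.* r Rg)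

  D : Set
  D = Structure.Carrier (apply 𝓘 𝔄)

  _≟ᵁ_ : DecidableEquality U
  _≟ᵁ_ = ≡-dec _≟_ (≡-dec _≟_ _≟_)

  data Shape : U → U → Set where
    el-el   : ∀ a → Shape (el Rg a) (el Rg a)
    row-row : ∀ i → Shape (row Rg i) (row Rg i)
    col-el  : ∀ j s → Shape (col Rg j) (el Rg s)

  shape : ∀ u v → ⟦ δ⋆ ⟧ 𝔄 (u ∷ v ∷ []) → Shape u v
  shape (inj₁ a) v (el⇒≡ , _)
    with decidable-stable (el Rg a ≟ᵁ v) (λ ≢ → el⇒≡ ((a , refl) , ≢))
  ... | refl = el-el a
  shape (inj₂ (inj₁ i)) v (_ , row⇒≡ , _)
    with decidable-stable (row Rg i ≟ᵁ v) (λ ≢ → row⇒≡ ((el Rg (b i) , i , refl , refl) , ≢))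
  ... | refl = row-row i
  shape (inj₂ (inj₂ j)) (inj₁ s) _ = col-el j s
  shape (inj₂ (inj₂ j)) (inj₂ w) (_ , _ , col⇒R) =
    ⊥-elim (col⇒R ((not-el , not-row) , λ { (_ , ()) }))
    where
    not-el : ¬ ∃ λ a → col Rg j ≡ el Rg a
    not-el (_ , ())
    not-row : ¬ ⟦ isRow X ⟧ 𝔄 (col Rg j ∷ inj₂ w ∷ [])
    not-row (_ , _ , () , _)

  δ⋆-shape : ∀ {u v} → Shape u v → ⟦ δ⋆ ⟧ 𝔄 (u ∷ v ∷ [])
  δ⋆-shape (el-el a) =
      (λ (_ , ≢) → ≢ refl)
    , (λ (_ , ≢) → ≢ refl)
    , λ ((not-el , _) , _) → not-el (a , refl)
  δ⋆-shape (row-row i) =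
      (λ { ((_ , ()) , _) })
    , (λ (_ , ≢) → ≢ refl)
    , λ ((_ , not-row) , _) → not-row (el Rg (b i) , i , refl , refl)
  δ⋆-shape (col-el j s) =
      (λ { ((_ , ()) , _) })
    , (λ { ((_ , _ , () , _) , _) })
    , λ (_ , not-el) → not-el (s , refl)

  decodePair : U → U → U⋆
  decodePair (inj₁ a)        _        = el Rg a
  decodePair (inj₂ (inj₁ i)) _        = row Rg i
  decodePair (inj₂ (inj₂ j)) (inj₁ s) = col Rg (combine j s)
  decodePair (inj₂ (inj₂ j)) (inj₂ _) = col Rg (combine j 0#)  -- excluded by δ⋆

  decode : D → U⋆
  decode (t , _) = decodePair (t X) (t Y)

  encodeTuple : U⋆ → D
  encodeTuple (inj₁ a)        = (el Rg a ∷ el Rg a ∷ []) , δ⋆-shape (el-el a)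
  encodeTuple (inj₂ (inj₁ i)) = (row Rg i ∷ row Rg i ∷ []) , δ⋆-shape (row-row i)
  encodeTuple (inj₂ (inj₂ k)) = (col Rg j ∷ el Rg s ∷ []) , δ⋆-shape (col-el j s)
    where
    j : Fin q
    j = quotient (r Rg) k
    s : Fin (r Rg)
    s = remainder {q} (r Rg) k

  _≈_ : Rel D 0ℓ
  _≈_ = eqv 𝓘 𝔄

  ≈-isEquivalence : IsEquivalence _≈_
  ≈-isEquivalence = record
    { refl  = refl , refl
    ; sym   = λ (eX , eY) → ≡.sym eX , ≡.sym eY
    ; trans = λ (eX , eY) (eX′ , eY′) → ≡.trans eX eX′ , ≡.trans eY eY′
    }

  decode-encodeTuple : ∀ x → decode (encodeTuple x) ≡ x
  decode-encodeTuple (inj₁ a)        = refl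
  decode-encodeTuple (inj₂ (inj₁ i)) = refl
  decode-encodeTuple (inj₂ (inj₂ k)) = ≡.cong (col Rg) (combine-remQuot {q} (r Rg) k)

  decode-cong : ∀ d d′ → d ≈ d′ → decode d ≡ decode d′
  decode-cong _ _ (eX , eY) = ≡.cong₂ decodePair eX eY

  encodeTuple-decode : ∀ d → encodeTuple (decode d) ≈ d
  encodeTuple-decode (t , δt) = section (shape (t X) (t Y) δt)
    where
    section : ∀ {u v} → Shape u v →
              let t′ = proj₁ (encodeTuple (decodePair u v)) in t′ X ≡ u × t′ Y ≡ v
    section (el-el a)    = refl , refl
    section (row-row i)  = refl , refl
    section (col-el j s) =
      ≡.cong (col Rg ∘ proj₁) (remQuot-combine j s) , ≡.cong (el Rg ∘ proj₂) (remQuot-combine j s)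

  decodePair-el : ∀ u v {a} → u ≡ el Rg a ⇔ decodePair u v ≡ el Rg a
  decodePair-el (inj₁ _)        _        = mk⇔ (λ { refl → refl }) (λ { refl → refl })
  decodePair-el (inj₂ (inj₁ _)) _        = mk⇔ (λ ()) (λ ())
  decodePair-el (inj₂ (inj₂ _)) (inj₁ _) = mk⇔ (λ ()) (λ ())
  decodePair-el (inj₂ (inj₂ _)) (inj₂ _) = mk⇔ (λ ()) (λ ())

  decodePair-row : ∀ u v {i} → u ≡ row Rg i ⇔ decodePair u v ≡ row Rg i
  decodePair-row (inj₁ _)        _        = mk⇔ (λ ()) (λ ())
  decodePair-row (inj₂ (inj₁ _)) _        = mk⇔ (λ { refl → refl }) (λ { refl → refl })
  decodePair-row (inj₂ (inj₂ _)) (inj₁ _) = mk⇔ (λ ()) (λ ())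
  decodePair-row (inj₂ (inj₂ _)) (inj₂ _) = mk⇔ (λ ()) (λ ())

  decodePair-col : ∀ {u v} → Shape u v → ∀ {j s} →
                   (u ≡ col Rg j × v ≡ el Rg s) ⇔ decodePair u v ≡ col Rg (combine j s)
  decodePair-col (el-el _)    = mk⇔ (λ { (() , _) }) (λ ())
  decodePair-col (row-row _)  = mk⇔ (λ { (() , _) }) (λ ())
  decodePair-col (col-el j s) = mk⇔ (λ { (refl , refl) → refl }) λ c≡c′ →
    let j≡j′ , s≡s′ = combine-injective j s _ _ (inj₂-injective (inj₂-injective c≡c′))
    in ≡.cong (col Rg) j≡j′ , ≡.cong (el Rg) s≡s′

  module _ {n} (ds : Fin n → D) {xs : Fin n → U⋆}
           (ds↦xs : ∀ k → decode (ds k) ≡ xs k) (k : Fin n) where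
    private
      t : Fin 2 → U
      t = proj₁ (ds k)

    el-decoded : ∀ {a} → t X ≡ el Rg a ⇔ xs k ≡ el Rg a
    el-decoded rewrite ≡.sym (ds↦xs k) = decodePair-el (t X) (t Y)

    row-decoded : ∀ {i} → t X ≡ row Rg i ⇔ xs k ≡ row Rg i
    row-decoded rewrite ≡.sym (ds↦xs k) = decodePair-row (t X) (t Y)

    col-decoded : ∀ {j s} → (t X ≡ col Rg j × t Y ≡ el Rg s) ⇔ xs k ≡ col Rg (combine j s)
    col-decoded rewrite ≡.sym (ds↦xs k) = decodePair-col (shape (t X) (t Y) (proj₂ (ds k)))

  CoefficientEntry : (Fin 3 × Fin 2 → U) → Set
  CoefficientEntry env = ∃ λ i → ∃ λ j → ∃ λ s →
      env (0F , X) ≡ row Rg i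
    × (env (1F , X) ≡ col Rg j × env (1F , Y) ≡ el Rg s)
    × env (2F , X) ≡ el Rg (coeff S i j s)

  φ⋆Aℓ-correct : ∀ env → ⟦ φ⋆Aℓ ⟧ 𝔄 env ⇔ CoefficientEntry env
  φ⋆Aℓ-correct env = mk⇔ to from
    where
    to : ⟦ φ⋆Aℓ ⟧ 𝔄 env → CoefficientEntry env
    to ( _ , _ , _ , _
       , (i , j , x₀≡i , x₁≡j , refl) , (_ , s , refl , y₁≡s , refl)
       , (j′ , i′ , x₁≡j′ , x₀≡i′ , refl) , (s′ , _ , y₁≡s′ , refl , refl)
       , (_ , _ , refl , refl , x₂≡))
      with ≡.trans (≡.sym x₀≡i) x₀≡i′
         | ≡.trans (≡.sym x₁≡j) x₁≡j′
         | ≡.trans (≡.sym y₁≡s) y₁≡s′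
    ... | refl | refl | refl = i , j , s , x₀≡i , (x₁≡j , y₁≡s) , x₂≡
    from : CoefficientEntry env → ⟦ φ⋆Aℓ ⟧ 𝔄 env
    from (i , j , s , x₀≡i , (x₁≡j , y₁≡s) , x₂≡) =
        _ , _ , _ , _
      , (i , j , x₀≡i , x₁≡j , refl) , (Al i j , s , refl , y₁≡s , refl)
      , (j , i , x₁≡j , x₀≡i , refl) , (s , Arm j i , y₁≡s , refl , refl)
      , (_ , _ , refl , refl , x₂≡)

  rel-Aℓ-decoded : ∀ ds {xs} → (∀ k → decode (ds k) ≡ xs k) →
                   rel (apply 𝓘 𝔄) Aℓ ds ⇔ rel 𝔄⋆ Aℓ xs
  rel-Aℓ-decoded ds {xs} ds↦xs = mk⇔ to from
    where
    open Equivalence using () renaming (to to ⇒; from to ⇐)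
    env : Fin 3 × Fin 2 → U
    env (k , c) = proj₁ (ds k) c
    to : rel (apply 𝓘 𝔄) Aℓ ds → rel 𝔄⋆ Aℓ xs
    to φ with ⇒ (φ⋆Aℓ-correct env) φ
    ... | i , j , s , x₀≡i , x₁y₁≡js , x₂≡ =
        i , combine j s
      , ⇒ (row-decoded ds ds↦xs 0F) x₀≡i
      , ⇒ (col-decoded ds ds↦xs 1F) x₁y₁≡js
      , ≡.trans (⇒ (el-decoded ds ds↦xs 2F) x₂≡) (≡.cong (el Rg) (≡.sym (A⋆-combine S i j s)))
    from : rel 𝔄⋆ Aℓ xs → rel (apply 𝓘 𝔄) Aℓ ds
    from (i , k , x₀≡i , x₁≡k , x₂≡) = ⇐ (φ⋆Aℓ-correct env)
      ( i , quotient (r Rg) k , remainder {q} (r Rg) k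
      , ⇐ (row-decoded ds ds↦xs 0F) x₀≡i
      , ⇐ (col-decoded ds ds↦xs 1F) (≡.trans x₁≡k (≡.cong (col Rg) (≡.sym (combine-remQuot {q} _ k))))
      , ⇐ (el-decoded ds ds↦xs 2F) x₂≡ )

  rel-decoded : ∀ s → Pinned s → ∀ ds xs → (∀ k → decode (ds k) ≡ xs k) →
                rel (apply 𝓘 𝔄) s ds ⇔ rel 𝔄⋆ s xs
  rel-decoded R   _ ds _ ds↦xs = congˡ (el-decoded ds ds↦xs 0F)
  rel-decoded Add _ ds _ ds↦xs =
    congˡ (congˡ (el-decoded ds ds↦xs 0F ×-⇔ el-decoded ds ds↦xs 1F ×-⇔ el-decoded ds ds↦xs 2F))
  rel-decoded Aℓ  _ ds _ ds↦xs = rel-Aℓ-decoded ds ds↦xs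
  rel-decoded B   _ ds _ ds↦xs = congˡ (row-decoded ds ds↦xs 0F ×-⇔ el-decoded ds ds↦xs 1F)

  describes : Describes 𝓘 𝔄 Rg (linearise S)
  describes = isoModulo-byDecoding ≈-isEquivalence encodeTuple decode
    decode-encodeTuple decode-cong encodeTuple-decode rel-decoded

lemma2p3 : Σ ℕ λ m → Σ (Interpretation m) λ 𝓘 →
    ∀ (Rg : FinRing) (S : System Rg) → Σ (ZSystem Rg) λ S⋆ →
      Describes 𝓘 (encode Rg S) Rg S⋆ × (Solvable Rg S ⇔ ZSolvable Rg S⋆)
lemma2p3 = 2 , 𝓘 , λ Rg S →
    Linearisation.linearise Rg S
  , Correctness.describes Rg S
  , Linearisation.solvable⇔linearised-solvable Rg S
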